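{- Let $C'$ be a column of $c'$ distinct positive integers and $S=\{a_1>\dots>a_c\}$, $c\in\{c',c'+1\}$, with $s_r\le e_r$ for all $r\le c'$ (where $s_1<\dots<s_c$ are the elements of $S$ and $e_1<\dots<e_{c'}$ the entries of $C'$ in increasing order). Let $\widehat{C}=\widehat{C}(S,C')$, and let $\beta$, $\mathcal{A}(\beta)$ and the action $\gamma.(\widehat{C}C')$ be as in the context. Then the map $\gamma\mapsto\gamma.\widehat{C}$ is a bijection from $\{\gamma\in\mathcal{A}(\beta):\gamma.(\widehat{C}C')\neq\emptyset\}$ onto the set of orderings $C$ of $S$ for which $CC'$ is HHL; i.e. $\mathcal{A}(\beta).\widehat{C}$ generates every such $C$, and each exactly once.
   Context: Hat construction: $\widehat{C}$ is the column of length $c$ obtained by processing the elements of $S$ in decreasing order: an element $a$ occurring in $C'$ is placed in the row in which $a$ occurs in $C'$; an element not occurring in $C'$ is placed, if $c=c'+1$ and row $c'+1$ is still empty, in row $c'+1$, and otherwise in the row of the largest entry of $C'$ whose row in the left column is still empty. A two-column configuration $CC'$ (top-aligned, lengths $c\in\{c',c'+1\}$) is HHL if entries in each column are distinct, $C(r)\le C'(r)$ for $r\le c'$, and $C(r)\ne C'(s)$ whenever $s<r$. Pivots: a row $q$ of $\widehat{C}C'$ is a pivot if $q\le c'$ and $\widehat{C}(q)<C'(q)$, or $q=c'+1\le c$; the pivot entries are the values $\widehat{C}(q)$ at pivot rows, listed $b_1>\dots>b_p$. The sequence $\beta$ has $c$ rows; row $l$ consists of the transpositions $(b<a_l)$ for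 all pivot entries $b<a_l$, listed in decreasing order of $b$. $\preceq$ is the total order reading $\beta$ row by row from top to bottom, each row left to right. $\mathcal{A}(\beta)$ is the set of subsequences of $\beta$ (in $\preceq$ order) containing at most one transposition from each row. A transposition $(b<a)$ acts on a left column by swapping the positions of the values $a$ and $b$. For $\gamma=(\sigma_1,\dots,\sigma_k)\in\mathcal{A}(\beta)$, $\gamma.\widehat{C}$ is the column obtained from $\widehat{C}$ by applying $\sigma_1$, then $\sigma_2$, ..., then $\sigma_k$; $\gamma.(\widehat{C}C')=(\gamma.\widehat{C})C'$ if this configuration is HHL and $\emptyset$ otherwise. -}

module Defs where

open import Data.Nat using (ℕ; zero; suc; _≤_; _<_; _>_; _≟_; _<?_; _≤?_)
open import Data.Nat.Properties using (≤-decTotalOrder)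
open import Data.Bool using (Bool; true; false; if_then_else_; _∧_)
open import Data.Maybe using (Maybe; just; nothing; fromMaybe)
open import Data.Product using (_×_; _,_; proj₁; proj₂)
open import Data.Sum using (_⊎_)
open import Data.List using (List; []; _∷_; length; map; filter; foldl; replicate; reverse; upTo; zip)
open import Data.List.Membership.Propositional using (_∈_)
open import Data.Fin using (Fin; toℕ)
open import Data.List.Relation.Unary.Unique.Propositional using (Unique)
open import Relation.Nullary.Decidable using (⌊_⌋)
open import Relation.Binary.PropositionalEquality using (_≡_; _≢_)
import Data.List.Sort.InsertionSort ≤-decTotalOrder as Sorting

-- Columns are lists of naturals, row 1 = head of the list.
-- All row indices below are 0-based (row r of the paper = index r-1).

sortℕ : List ℕ → List ℕ
sortℕ = Sorting.sort

-- ℕ-indexed lookup with default 0 (only used inside in-range definitions)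
nth : List ℕ → ℕ → ℕ
nth []       _       = 0
nth (x ∷ xs) zero    = x
nth (x ∷ xs) (suc n) = nth xs n

record HHL (C C' : List ℕ) : Set where
  field
    lengths   : length C ≡ length C' ⊎ length C ≡ suc (length C')
    distinctL : Unique C
    distinctR : Unique C'
    rowLe     : (i : Fin (length C)) (j : Fin (length C')) →
                toℕ i ≡ toℕ j → Data.List.lookup C i ≤ Data.List.lookup C' j
    noUpper   : (i : Fin (length C)) (j : Fin (length C')) →
                toℕ j < toℕ i → Data.List.lookup C i ≢ Data.List.lookup C' j

-- Hat construction.  A partially filled left column is a list of
-- Maybe ℕ (nothing = empty row).

indexOf : ℕ → List ℕ → Maybe ℕ
indexOf a []       = nothing
indexOf a (x ∷ xs) with ⌊ a ≟ x ⌋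
... | true  = just zero
... | false = Data.Maybe.map suc (indexOf a xs)

emptyAt : List (Maybe ℕ) → ℕ → Bool
emptyAt []             _       = false
emptyAt (nothing ∷ _)  zero    = true
emptyAt (just _ ∷ _)   zero    = false
emptyAt (_ ∷ xs)       (suc r) = emptyAt xs r

setAt : List (Maybe ℕ) → ℕ → ℕ → List (Maybe ℕ)
setAt []       _       a = []
setAt (_ ∷ xs) zero    a = just a ∷ xs
setAt (x ∷ xs) (suc r) a = x ∷ setAt xs r a

largestEmpty : List (Maybe ℕ) → List (ℕ × ℕ) → Maybe ℕ
largestEmpty st rs = Data.Maybe.map proj₁ (go rs nothing)
  where
  go : List (ℕ × ℕ) → Maybe (ℕ × ℕ) → Maybe (ℕ × ℕ)
  go []             best = best
  go ((r , e) ∷ xs) best with emptyAt st r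
  ... | false = go xs best
  ... | true with best
  ...   | nothing       = go xs (just (r , e))
  ...   | just (r' , e') = if ⌊ e' <? e ⌋ then go xs (just (r , e)) else go xs best

hatStep : (c : ℕ) → List ℕ → List (Maybe ℕ) → ℕ → List (Maybe ℕ)
hatStep c C' st a with indexOf a C'
... | just r  = setAt st r a
... | nothing =
  if ⌊ c ≟ suc (length C') ⌋ ∧ emptyAt st (length C')
  then setAt st (length C') a
  else place (largestEmpty st (zip (upTo (length C')) C'))
  where
  place : Maybe ℕ → List (Maybe ℕ)
  place (just r) = setAt st r a
  place nothing  = st

-- \hat C (S , C') ; S is given as the list a_1 > ... > a_c, so the
-- elements are processed in list order (= decreasing order).
hat : List ℕ → List ℕ → List ℕ
hat S C' = map (fromMaybe 0)
  (foldl (hatStep (length S) C') (replicate (length S) nothing) S)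

isPivot : List ℕ → List ℕ → ℕ → Bool
isPivot Ĉ C' q =
  (⌊ q <? length C' ⌋ ∧ ⌊ nth Ĉ q <? nth C' q ⌋) Data.Bool.∨ ⌊ q ≟ length C' ⌋

pivotEntries : List ℕ → List ℕ → List ℕ
pivotEntries Ĉ C' =
  reverse (sortℕ (map (nth Ĉ) (filter (λ q → Data.Bool.T? (isPivot Ĉ C' q)) (upTo (length Ĉ)))))

-- a transposition (b < a) is represented by the pair (b , a)
Transposition : Set
Transposition = ℕ × ℕ

beta : List ℕ → List ℕ → List (List Transposition)
beta S C' = map row S
  where
  bs = pivotEntries (hat S C') C'
  row : ℕ → List Transposition
  row a = map (λ b → (b , a)) (filter (_<? a) bs)

data Admissible : List (List Transposition) → List Transposition → Set where
  done : Admissible [] []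
  skip : ∀ {row rows γ} → Admissible rows γ → Admissible (row ∷ rows) γ
  pick : ∀ {row rows γ t} → t ∈ row → Admissible rows γ → Admissible (row ∷ rows) (t ∷ γ)

swapVals : Transposition → List ℕ → List ℕ
swapVals (b , a) = map f
  where
  f : ℕ → ℕ
  f x = if ⌊ x ≟ a ⌋ then b else (if ⌊ x ≟ b ⌋ then a else x)

-- γ.C : apply σ₁ first, then σ₂, ...
act : List Transposition → List ℕ → List ℕ
act γ C = foldl (λ col σ → swapVals σ col) C γ

-- Ĉ puts each element of S ∩ C' in its own row of C' and every other element
-- of S into a pivot row.  The hypothesis s_r ≤ e_r is used in its counting form:
-- for every t, S has at most (c − c') more elements ≥ t than C' has.  Hence,
-- when an element a ∉ C' is placed, some still empty row of C' carries an
-- entry ≥ a, and the placement rule never puts a above a smaller entry of C'.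
--
-- Row l of β only holds transpositions moving a_l, and later rows only move
-- values smaller than a_l; so the final row of a_l in γ.Ĉ records which
-- transposition row l contributed to γ, and γ ↦ γ.Ĉ is injective.  Conversely,
-- given an HHL ordering C of S, treat a_1 > a_2 > ... in turn and swap a_l into
-- its row j of C.  The displaced value b is smaller than a_l and not in C'
-- (else b would already sit in its own row of C', forcing a_l = C(j) ≤ C'(j) = b),
-- so b is a pivot entry and (b < a_l) is a letter of row l of β.
--
-- Positivity of the entries is not needed: every row of Ĉ gets filled, so the
-- default entry 0 of hat never occurs.

module Submission where

open import Defs
open import Data.Bool using (Bool; true; false; _∧_; T?; if_then_else_)
open import Data.Bool.Properties using (T-≡; ∨-zeroʳ)
open import Data.Maybe using (Maybe; just; nothing; fromMaybe; is-just)
open import Data.Maybe.Properties using (just-injective)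
open import Function using (_∘_; id)
open import Data.Fin using (fromℕ<)
open import Data.Fin.Properties using (toℕ-fromℕ<)
open import Data.List using (List; []; _∷_; length; map; filter; take; drop; reverse; replicate; zip; applyUpTo; upTo; foldl; _++_; [_])
open import Data.List.Properties using (++-assoc; ++-identityʳ; map-∘; map-cong; ∷-injectiveˡ; ∷-injectiveʳ; length-map; length-replicate; filter-++; filter-all; filter-accept; filter-reject; length-++; length-filter; length-drop; length-reverse; take++drop≡id)
open import Data.List.Membership.Propositional using (_∈_; _∉_)
open import Data.List.Membership.Propositional.Properties using (∈-++⁺ˡ; ∈-++⁺ʳ; ∈-++⁻; ∈-map⁺; ∈-map⁻; ∈-filter⁺; ∈-filter⁻; ∈-upTo⁺; ∈-upTo⁻)
open import Data.List.Membership.Propositional.Properties.WithK using (unique∧set⇒bag)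
open import Data.List.Relation.Binary.BagAndSetEquality using (∼bag⇒↭)
open import Data.List.Relation.Binary.Permutation.Propositional using (_↭_; ↭-trans; ↭-sym)
open import Data.List.Relation.Binary.Permutation.Propositional.Properties using (filter-↭; ↭-length; ↭-reverse; ∈-resp-↭)
open import Data.List.Relation.Binary.Pointwise using (Pointwise; []; _∷_)
open import Data.List.Relation.Binary.Subset.Propositional using (_⊆_)
open import Data.List.Relation.Unary.All using (All; []; _∷_)
import Data.List.Relation.Unary.All as All
open import Data.List.Relation.Unary.AllPairs using (AllPairs; []; _∷_)
import Data.List.Relation.Unary.AllPairs as AllPairs
open import Data.List.Relation.Unary.Linked using (Linked)
open import Data.List.Relation.Unary.Linked.Properties using (Linked⇒AllPairs)
import Data.List.Relation.Unary.Unique.Propositional.Properties as Unique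
open import Data.List.Relation.Unary.Any using (Any; here; there)
import Data.List.Relation.Unary.Any as Any
open import Data.List.Relation.Unary.Unique.Propositional using (Unique)
open import Data.Nat using (ℕ; zero; suc; _≤_; _<_; _>_; _+_; _∸_; z≤n; s≤s; _≤?_; _<?_; _≟_)
open import Data.Nat.Properties
open import Data.List.Sort.InsertionSort.Properties ≤-decTotalOrder using (sort-↭)
open import Data.Product using (_×_; _,_; proj₁; proj₂; ∃; ∃-syntax; map₁; map₂)
open import Data.Empty using (⊥; ⊥-elim)
open import Data.Sum using (_⊎_; inj₁; inj₂; [_,_]′)
open import Function.Bundles using (mk⇔; Equivalence)
open import Relation.Nullary using (¬_; Dec; yes; no)
open import Relation.Nullary.Decidable using (⌊_⌋; toWitness; dec-true; dec-false; isYes≗does)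
open import Relation.Binary.PropositionalEquality using (_≡_; _≢_; refl; module ≡-Reasoning; sym; trans; cong; cong₂; subst; subst₂)

nth-∈ : ∀ xs i → i < length xs → nth xs i ∈ xs
nth-∈ (x ∷ xs) zero    _       = here refl
nth-∈ (x ∷ xs) (suc i) (s≤s p) = there (nth-∈ xs i p)

∈⇒nth : ∀ {x} xs → x ∈ xs → ∃[ i ] i < length xs × nth xs i ≡ x
∈⇒nth (y ∷ xs) (here refl) = 0 , s≤s z≤n , refl
∈⇒nth (y ∷ xs) (there p) with i , i< , eq ← ∈⇒nth xs p = suc i , s≤s i< , eq

nth-injective : ∀ {xs} → Unique xs → ∀ i j → i < length xs → j < length xs →
                nth xs i ≡ nth xs j → i ≡ j
nth-injective (_ ∷ _)  zero    zero    _       _       _  = refl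
nth-injective {_ ∷ xs} (x∉ ∷ _) zero    (suc j) _       (s≤s q) eq = ⊥-elim (All.lookup x∉ (nth-∈ xs j q) eq)
nth-injective {_ ∷ xs} (x∉ ∷ _) (suc i) zero    (s≤s p) _       eq = ⊥-elim (All.lookup x∉ (nth-∈ xs i p) (sym eq))
nth-injective (_ ∷ u)  (suc i) (suc j) (s≤s p) (s≤s q) eq = cong suc (nth-injective u i j p q eq)

nth-injective⇒Unique : ∀ xs → (∀ i j → i < length xs → j < length xs → nth xs i ≡ nth xs j → i ≡ j) →
                       Unique xs
nth-injective⇒Unique []       _   = []
nth-injective⇒Unique (x ∷ xs) inj =
  All.tabulate x≢ ∷ nth-injective⇒Unique xs (λ i j p q eq → suc-injective (inj (suc i) (suc j) (s≤s p) (s≤s q) eq))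
  where
  x≢ : ∀ {y} → y ∈ xs → x ≡ y → ⊥
  x≢ y∈ x≡y with j , j< , refl ← ∈⇒nth xs y∈ with () ← inj 0 (suc j) (s≤s z≤n) (s≤s j<) x≡y

nth-extensional : ∀ xs ys → length xs ≡ length ys → (∀ i → i < length xs → nth xs i ≡ nth ys i) → xs ≡ ys
nth-extensional []       []       _   _  = refl
nth-extensional (x ∷ xs) (y ∷ ys) len eq =
  cong₂ _∷_ (eq 0 (s≤s z≤n)) (nth-extensional xs ys (suc-injective len) (λ i p → eq (suc i) (s≤s p)))

nth-map : ∀ (f : ℕ → ℕ) xs i → i < length xs → nth (map f xs) i ≡ f (nth xs i)
nth-map f (x ∷ xs) zero    _       = refl
nth-map f (x ∷ xs) (suc i) (s≤s p) = nth-map f xs i p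

lookup-fromℕ< : ∀ xs i (p : i < length xs) → Data.List.lookup xs (fromℕ< p) ≡ nth xs i
lookup-fromℕ< (x ∷ xs) zero    _       = refl
lookup-fromℕ< (x ∷ xs) (suc i) (s≤s p) = lookup-fromℕ< xs i p

AllPairs>⇒Unique : ∀ {xs} → AllPairs _>_ xs → Unique xs
AllPairs>⇒Unique = AllPairs.map (λ x>y x≡y → <-irrefl (sym x≡y) x>y)

unique-⊆-⊇⇒↭ : {xs ys : List ℕ} → Unique xs → Unique ys → xs ⊆ ys → ys ⊆ xs → xs ↭ ys
unique-⊆-⊇⇒↭ ux uy xs⊆ys ys⊆xs = ∼bag⇒↭ (unique∧set⇒bag ux uy (mk⇔ xs⊆ys ys⊆xs))

module _ {R : ℕ → ℕ → Set} where

  AllPairs-++-across : ∀ xs {ys x y} → AllPairs R (xs ++ ys) → x ∈ xs → y ∈ ys → R x y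
  AllPairs-++-across (_ ∷ xs) (x∼ ∷ _)  (here refl) y∈ = All.lookup x∼ (∈-++⁺ʳ xs y∈)
  AllPairs-++-across (_ ∷ xs) (_ ∷ ps) (there x∈)  y∈ = AllPairs-++-across xs ps x∈ y∈

  AllPairs-++-right : ∀ xs {ys} → AllPairs R (xs ++ ys) → AllPairs R ys
  AllPairs-++-right []       ps       = ps
  AllPairs-++-right (_ ∷ xs) (_ ∷ ps) = AllPairs-++-right xs ps

isYes-true : ∀ {A : Set} (a? : Dec A) → A → ⌊ a? ⌋ ≡ true
isYes-true a? a = trans (isYes≗does a?) (dec-true a? a)

isYes-false : ∀ {A : Set} (a? : Dec A) → ¬ A → ⌊ a? ⌋ ≡ false
isYes-false a? ¬a = trans (isYes≗does a?) (dec-false a? ¬a)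

private
  just≢nothing : ∀ {v : ℕ} → just v ≢ nothing
  just≢nothing ()

  nothing≢just : ∀ {v : ℕ} → nothing ≢ just v
  nothing≢just ()

  is-just≡false⇒nothing : ∀ {m : Maybe ℕ} → is-just m ≡ false → m ≡ nothing
  is-just≡false⇒nothing {nothing} _ = refl

  ∧≡true⇒ʳ : ∀ {x y} → x ∧ y ≡ true → y ≡ true
  ∧≡true⇒ʳ {true} eq = eq

  true≢false : true ≢ false
  true≢false ()

  true-or-false : ∀ b → b ≡ true ⊎ b ≡ false
  true-or-false true  = inj₁ refl
  true-or-false false = inj₂ refl

indicator : Bool → ℕ
indicator true  = 1
indicator false = 0

countIdx : (ℕ → Bool) → ℕ → ℕ
countIdx p zero    = 0
countIdx p (suc n) = countIdx p n + indicator (p n)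

countIdx-cong : ∀ p q n → (∀ i → i < n → p i ≡ q i) → countIdx p n ≡ countIdx q n
countIdx-cong p q zero    _  = refl
countIdx-cong p q (suc n) eq = cong₂ _+_ (countIdx-cong p q n (λ i i< → eq i (m≤n⇒m≤1+n i<))) (cong indicator (eq n ≤-refl))

countIdx-none : ∀ p n → (∀ i → p i ≡ false) → countIdx p n ≡ 0
countIdx-none p zero    _    = refl
countIdx-none p (suc n) none rewrite none n | countIdx-none p n none = refl

countIdx≤n : ∀ p n → countIdx p n ≤ n
countIdx≤n p zero    = z≤n
countIdx≤n p (suc n) with p n
... | true  = ≤-trans (+-monoˡ-≤ 1 (countIdx≤n p n)) (≤-reflexive (+-comm n 1))
... | false = ≤-trans (≤-reflexive (+-identityʳ _)) (m≤n⇒m≤1+n (countIdx≤n p n))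

countIdx≡n⇒all : ∀ p n → countIdx p n ≡ n → ∀ i → i < n → p i ≡ true
countIdx≡n⇒all p (suc n) full i i< with p n in pn | m≤n⇒m<n∨m≡n (≤-pred i<)
... | true  | inj₁ i<n  = countIdx≡n⇒all p n (suc-injective (trans (+-comm 1 _) full)) i i<n
... | true  | inj₂ refl = pn
... | false | _         = ⊥-elim (<-irrefl refl (≤-trans (≤-reflexive (trans (sym full) (+-identityʳ _))) (countIdx≤n p n)))

countIdx-flip : ∀ p q n r → r < n → p r ≡ false → q r ≡ true →
                (∀ i → i < n → i ≢ r → q i ≡ p i) → countIdx q n ≡ suc (countIdx p n)
countIdx-flip p q (suc n) r r< pr qr same with m≤n⇒m<n∨m≡n (≤-pred r<)
... | inj₁ r<n
  rewrite countIdx-flip p q n r r<n pr qr (λ i i< → same i (m≤n⇒m≤1+n i<))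
        | same n ≤-refl (λ n≡r → <-irrefl (sym n≡r) r<n) = refl
... | inj₂ refl
  rewrite pr | qr | countIdx-cong q p r (λ i i< → same i (m≤n⇒m≤1+n i<) (λ i≡r → <-irrefl i≡r i<)) =
  trans (+-comm (countIdx p r) 1) (cong suc (sym (+-identityʳ (countIdx p r))))

countIdx-pigeonhole : ∀ p q n → countIdx q n < countIdx p n → ∃[ i ] i < n × p i ≡ true × q i ≡ false
countIdx-pigeonhole p q (suc n) lt with p n in pn | q n in qn
... | true  | false = n , ≤-refl , pn , qn
... | true  | true  = map₂ (map₁ m≤n⇒m≤1+n) (countIdx-pigeonhole p q n (+-cancelʳ-< _ _ _ lt))
... | false | false = map₂ (map₁ m≤n⇒m≤1+n) (countIdx-pigeonhole p q n (subst₂ _<_ (+-identityʳ _) (+-identityʳ _) lt))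
... | false | true  = map₂ (map₁ m≤n⇒m≤1+n) (countIdx-pigeonhole p q n (≤-trans (m+n≤o⇒m≤o (suc (countIdx q n)) lt) (≤-reflexive (+-identityʳ _))))

countIdx-suc : ∀ p n → countIdx p (suc n) ≡ indicator (p 0) + countIdx (λ i → p (suc i)) n
countIdx-suc p zero    = +-comm 0 (indicator (p 0))
countIdx-suc p (suc n) rewrite countIdx-suc p n = +-assoc (indicator (p 0)) _ (indicator (p (suc n)))

countAtLeast : ℕ → List ℕ → ℕ
countAtLeast t xs = length (filter (t ≤?_) xs)

countAtLeast-↭ : ∀ t {xs ys} → xs ↭ ys → countAtLeast t xs ≡ countAtLeast t ys
countAtLeast-↭ t p = ↭-length (filter-↭ (t ≤?_) p)

countAtLeast-++ : ∀ t xs ys → countAtLeast t (xs ++ ys) ≡ countAtLeast t xs + countAtLeast t ys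
countAtLeast-++ t xs ys = trans (cong length (filter-++ (t ≤?_) xs ys)) (length-++ (filter (t ≤?_) xs))

countAtLeast-all : ∀ t {xs} → All (t ≤_) xs → countAtLeast t xs ≡ length xs
countAtLeast-all t all = cong length (filter-all (t ≤?_) all)

countAtLeast-accept : ∀ t {x} xs → t ≤ x → countAtLeast t (x ∷ xs) ≡ suc (countAtLeast t xs)
countAtLeast-accept t xs t≤x = cong length (filter-accept (t ≤?_) t≤x)

countAtLeast-reject : ∀ t {x} xs → ¬ t ≤ x → countAtLeast t (x ∷ xs) ≡ countAtLeast t xs
countAtLeast-reject t xs t≰x = cong length (filter-reject (t ≤?_) t≰x)

countAtLeast-mono : ∀ t {xs ys} → Pointwise _≤_ xs ys → countAtLeast t xs ≤ countAtLeast t ys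
countAtLeast-mono t []                        = z≤n
countAtLeast-mono t (_∷_ {x} {y} {xs} {ys} x≤y p) with t ≤? x | t ≤? y
... | yes t≤x | yes t≤y
  rewrite countAtLeast-accept t xs t≤x | countAtLeast-accept t ys t≤y = s≤s (countAtLeast-mono t p)
... | yes t≤x | no  t≰y = ⊥-elim (t≰y (≤-trans t≤x x≤y))
... | no  t≰x | yes t≤y
  rewrite countAtLeast-reject t xs t≰x | countAtLeast-accept t ys t≤y = m≤n⇒m≤1+n (countAtLeast-mono t p)
... | no  t≰x | no  t≰y
  rewrite countAtLeast-reject t xs t≰x | countAtLeast-reject t ys t≰y = countAtLeast-mono t p

countIdx-nth : ∀ t xs → countIdx (λ i → ⌊ t ≤? nth xs i ⌋) (length xs) ≡ countAtLeast t xs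
countIdx-nth t []       = refl
countIdx-nth t (x ∷ xs) with t ≤? x | countIdx-suc (λ i → ⌊ t ≤? nth (x ∷ xs) i ⌋) (length xs)
... | yes t≤x | eq = trans eq (trans (cong suc (countIdx-nth t xs)) (sym (countAtLeast-accept t xs t≤x)))
... | no  t≰x | eq = trans eq (trans (countIdx-nth t xs) (sym (countAtLeast-reject t xs t≰x)))

smallest-dominated⇒countAtLeast≤ : ∀ C' S → Pointwise _≤_ (take (length C') (reverse S)) (sortℕ C') →
  ∀ t → countAtLeast t S ≤ countAtLeast t C' + (length S ∸ length C')
smallest-dominated⇒countAtLeast≤ C' S dom t = begin
  countAtLeast t S                                        ≡⟨ countAtLeast-↭ t (↭-reverse S) ⟨
  countAtLeast t (reverse S)                              ≡⟨ cong (countAtLeast t) (take++drop≡id k (reverse S)) ⟨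
  countAtLeast t (take k (reverse S) ++ drop k (reverse S)) ≡⟨ countAtLeast-++ t (take k (reverse S)) _ ⟩
  countAtLeast t (take k (reverse S)) + countAtLeast t (drop k (reverse S))
    ≤⟨ +-mono-≤ (countAtLeast-mono t dom) (length-filter (t ≤?_) (drop k (reverse S))) ⟩
  countAtLeast t (sortℕ C') + length (drop k (reverse S))
    ≡⟨ cong₂ _+_ (countAtLeast-↭ t (sort-↭ C')) (trans (length-drop k (reverse S)) (cong (_∸ k) (length-reverse S))) ⟩
  countAtLeast t C' + (length S ∸ k)                      ∎
  where
  k : ℕ
  k = length C'
  open ≤-Reasoning

rowAt : List (Maybe ℕ) → ℕ → Maybe ℕ
rowAt []       _       = nothing
rowAt (x ∷ xs) zero    = x
rowAt (x ∷ xs) (suc r) = rowAt xs r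

filled : List (Maybe ℕ) → ℕ → Bool
filled st r = is-just (rowAt st r)

emptyAt⇒nothing : ∀ st r → emptyAt st r ≡ true → r < length st × rowAt st r ≡ nothing
emptyAt⇒nothing (nothing ∷ st) zero    _  = s≤s z≤n , refl
emptyAt⇒nothing (nothing ∷ st) (suc r) em = map₁ s≤s (emptyAt⇒nothing st r em)
emptyAt⇒nothing (just _ ∷ st)  (suc r) em = map₁ s≤s (emptyAt⇒nothing st r em)

nothing⇒emptyAt : ∀ st r → r < length st → rowAt st r ≡ nothing → emptyAt st r ≡ true
nothing⇒emptyAt (nothing ∷ st) zero    _       _  = refl
nothing⇒emptyAt (nothing ∷ st) (suc r) (s≤s p) eq = nothing⇒emptyAt st r p eq
nothing⇒emptyAt (just _ ∷ st)  (suc r) (s≤s p) eq = nothing⇒emptyAt st r p eq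

¬emptyAt⇒filled : ∀ st r → r < length st → emptyAt st r ≡ false → filled st r ≡ true
¬emptyAt⇒filled (just _ ∷ st)  zero    _       _  = refl
¬emptyAt⇒filled (nothing ∷ st) (suc r) (s≤s p) ne = ¬emptyAt⇒filled st r p ne
¬emptyAt⇒filled (just _ ∷ st)  (suc r) (s≤s p) ne = ¬emptyAt⇒filled st r p ne

length-setAt : ∀ st r a → length (setAt st r a) ≡ length st
length-setAt []       _       _ = refl
length-setAt (_ ∷ st) zero    _ = refl
length-setAt (_ ∷ st) (suc r) a = cong suc (length-setAt st r a)

rowAt-setAt-same : ∀ st r a → r < length st → rowAt (setAt st r a) r ≡ just a
rowAt-setAt-same (_ ∷ st) zero    _ _       = refl
rowAt-setAt-same (_ ∷ st) (suc r) a (s≤s p) = rowAt-setAt-same st r a p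

rowAt-setAt-other : ∀ st r a q → q ≢ r → rowAt (setAt st r a) q ≡ rowAt st q
rowAt-setAt-other []       _       _ _       _   = refl
rowAt-setAt-other (_ ∷ st) zero    _ zero    q≢r = ⊥-elim (q≢r refl)
rowAt-setAt-other (_ ∷ st) zero    _ (suc q) _   = refl
rowAt-setAt-other (_ ∷ st) (suc r) _ zero    _   = refl
rowAt-setAt-other (_ ∷ st) (suc r) a (suc q) q≢r = rowAt-setAt-other st r a q (q≢r ∘ cong suc)

rowAt-just⇒< : ∀ st r {v} → rowAt st r ≡ just v → r < length st
rowAt-just⇒< (_ ∷ st) zero    _  = s≤s z≤n
rowAt-just⇒< (_ ∷ st) (suc r) eq = s≤s (rowAt-just⇒< st r eq)

rowAt-replicate : ∀ n r → rowAt (replicate n nothing) r ≡ nothing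
rowAt-replicate zero    _       = refl
rowAt-replicate (suc n) zero    = refl
rowAt-replicate (suc n) (suc r) = rowAt-replicate n r

nth-fromMaybe : ∀ st r → nth (map (fromMaybe 0) st) r ≡ fromMaybe 0 (rowAt st r)
nth-fromMaybe []       _       = refl
nth-fromMaybe (_ ∷ st) zero    = refl
nth-fromMaybe (_ ∷ st) (suc r) = nth-fromMaybe st r

indexOf-just : ∀ a xs s → indexOf a xs ≡ just s → nth xs s ≡ a × s < length xs
indexOf-just a (x ∷ xs) s eq with a ≟ x
indexOf-just a (x ∷ xs) zero refl | yes a≡x = sym a≡x , s≤s z≤n
... | no _ with indexOf a xs in eq′
indexOf-just a (x ∷ xs) .(suc s′) refl | no _ | just s′ = map₂ s≤s (indexOf-just a xs s′ eq′)

indexOf-nothing : ∀ a xs → indexOf a xs ≡ nothing → a ∉ xs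
indexOf-nothing a (x ∷ xs) eq a∈ with a ≟ x
indexOf-nothing a (x ∷ xs) () a∈ | yes _
... | no a≢x with indexOf a xs in eq′
indexOf-nothing a (x ∷ xs) eq (here a≡x) | no a≢x | nothing = a≢x a≡x
indexOf-nothing a (x ∷ xs) eq (there a∈) | no a≢x | nothing = indexOf-nothing a xs eq′ a∈

module _ (st : List (Maybe ℕ)) where

  largestEmpty-filled : ∀ r e xs → emptyAt st r ≡ false →
                        largestEmpty st ((r , e) ∷ xs) ≡ largestEmpty st xs
  largestEmpty-filled r e xs f rewrite f = refl

  largestEmpty-single : ∀ r e → emptyAt st r ≡ true → largestEmpty st ((r , e) ∷ []) ≡ just r
  largestEmpty-single r e em rewrite em = refl

  largestEmpty-skipFilled : ∀ r e r₂ e₂ xs → emptyAt st r ≡ true → emptyAt st r₂ ≡ false →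
    largestEmpty st ((r , e) ∷ (r₂ , e₂) ∷ xs) ≡ largestEmpty st ((r , e) ∷ xs)
  largestEmpty-skipFilled r e r₂ e₂ xs em f₂ rewrite em | f₂ = refl

  largestEmpty-replace : ∀ r e r₂ e₂ xs → emptyAt st r ≡ true → emptyAt st r₂ ≡ true → e < e₂ →
    largestEmpty st ((r , e) ∷ (r₂ , e₂) ∷ xs) ≡ largestEmpty st ((r₂ , e₂) ∷ xs)
  largestEmpty-replace r e r₂ e₂ xs em em₂ e<e₂ rewrite em | em₂ with e <? e₂
  ... | yes _   = refl
  ... | no  e≮e₂ = ⊥-elim (e≮e₂ e<e₂)

  largestEmpty-keep : ∀ r e r₂ e₂ xs → emptyAt st r ≡ true → emptyAt st r₂ ≡ true → ¬ e < e₂ →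
    largestEmpty st ((r , e) ∷ (r₂ , e₂) ∷ xs) ≡ largestEmpty st ((r , e) ∷ xs)
  largestEmpty-keep r e r₂ e₂ xs em em₂ e≮e₂ rewrite em | em₂ with e <? e₂
  ... | yes e<e₂ = ⊥-elim (e≮e₂ e<e₂)
  ... | no  _    = refl

  Candidate : ℕ → ℕ × ℕ → Set
  Candidate t (r , e) = emptyAt st r ≡ true × t ≤ e

  module _ (Q : ℕ × ℕ → Set) (t : ℕ) where

    Chosen : Maybe ℕ → Set
    Chosen m = ∃[ r ] ∃[ e ] m ≡ just r × Q (r , e) × Candidate t (r , e)

    private
      tail-filled : ∀ {r e xs} → emptyAt st r ≡ false → Any (Candidate t) ((r , e) ∷ xs) → Any (Candidate t) xs
      tail-filled f (here (em , _)) = ⊥-elim (true≢false (trans (sym em) f))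
      tail-filled f (there cs)      = cs

      narrow : ∀ {e e'} p xs → (t ≤ e → t ≤ e') → (Candidate t p → t ≤ e') →
               t ≤ e ⊎ Any (Candidate t) (p ∷ xs) → t ≤ e' ⊎ Any (Candidate t) xs
      narrow p xs f g (inj₁ t≤e)        = inj₁ (f t≤e)
      narrow p xs f g (inj₂ (here c))   = inj₁ (g c)
      narrow p xs f g (inj₂ (there cs)) = inj₂ cs

    -- The accumulator of largestEmpty is local to its definition; a list headed
    -- by an empty row stands for the state whose current best is that row.
    largestEmpty-chosen-from : ∀ r e xs → emptyAt st r ≡ true → Q (r , e) → All Q xs →
      t ≤ e ⊎ Any (Candidate t) xs → Chosen (largestEmpty st ((r , e) ∷ xs))
    largestEmpty-chosen-from r e [] em q [] (inj₁ t≤e) = r , e , largestEmpty-single r e em , q , em , t≤e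
    largestEmpty-chosen-from r e ((r₂ , e₂) ∷ xs) em q (q₂ ∷ qs) found with true-or-false (emptyAt st r₂)
    ... | inj₂ em₂ = subst Chosen (sym (largestEmpty-skipFilled r e r₂ e₂ xs em em₂))
      (largestEmpty-chosen-from r e xs em q qs (narrow _ xs id (λ (em₂' , _) → ⊥-elim (true≢false (trans (sym em₂') em₂))) found))
    ... | inj₁ em₂ with e <? e₂
    ...   | yes e<e₂ = subst Chosen (sym (largestEmpty-replace r e r₂ e₂ xs em em₂ e<e₂))
      (largestEmpty-chosen-from r₂ e₂ xs em₂ q₂ qs (narrow _ xs (λ t≤e → ≤-trans t≤e (<⇒≤ e<e₂)) proj₂ found))
    ...   | no e≮e₂  = subst Chosen (sym (largestEmpty-keep r e r₂ e₂ xs em em₂ e≮e₂))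
      (largestEmpty-chosen-from r e xs em q qs (narrow _ xs id (λ (_ , t≤e₂) → ≤-trans t≤e₂ (≮⇒≥ e≮e₂)) found))

    largestEmpty-chosen : ∀ xs → All Q xs → Any (Candidate t) xs → Chosen (largestEmpty st xs)
    largestEmpty-chosen ((r , e) ∷ xs) (q ∷ qs) found with true-or-false (emptyAt st r)
    ... | inj₁ em = largestEmpty-chosen-from r e xs em q qs (narrow _ xs id proj₂ (inj₂ found))
    ... | inj₂ em = subst Chosen (sym (largestEmpty-filled r e xs em))
      (largestEmpty-chosen xs qs (tail-filled em found))

zip-applyUpTo-entries : ∀ (f : ℕ → ℕ) xs →
  All (λ (r , e) → ∃[ i ] r ≡ f i × i < length xs × nth xs i ≡ e) (zip (applyUpTo f (length xs)) xs)
zip-applyUpTo-entries f []       = []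
zip-applyUpTo-entries f (x ∷ xs) =
  (0 , refl , s≤s z≤n , refl) ∷ All.map (λ (i , eq , i< , nth≡) → suc i , eq , s≤s i< , nth≡) (zip-applyUpTo-entries (f ∘ suc) xs)

zip-applyUpTo-any : ∀ (P : ℕ × ℕ → Set) (f : ℕ → ℕ) xs i → i < length xs → P (f i , nth xs i) →
  Any P (zip (applyUpTo f (length xs)) xs)
zip-applyUpTo-any P f (x ∷ xs) zero    _       p = here p
zip-applyUpTo-any P f (x ∷ xs) (suc i) (s≤s i<) p = there (zip-applyUpTo-any P (f ∘ suc) xs i i< p)

-- The hat construction

isPivot-intro : ∀ H C' q → q < length C' × nth H q < nth C' q ⊎ q ≡ length C' → isPivot H C' q ≡ true
isPivot-intro H C' q (inj₁ (q< , Hq<)) rewrite isYes-true (q <? length C') q< | isYes-true (nth H q <? nth C' q) Hq< = refl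
isPivot-intro H C' q (inj₂ q≡)         rewrite isYes-true (q ≟ length C') q≡ = ∨-zeroʳ _

module HatConstruction (C' S : List ℕ) (C'-unique : Unique C') (S-decreasing : AllPairs _>_ S)
  (lengths : length S ≡ length C' ⊎ length S ≡ suc (length C'))
  (dominated : ∀ t → countAtLeast t S ≤ countAtLeast t C' + (length S ∸ length C')) where

  c c' : ℕ
  c  = length S
  c' = length C'

  c'≤c : c' ≤ c
  c'≤c = [ (λ c≡c' → ≤-reflexive (sym c≡c')) , (λ c≡1+c' → ≤-trans (n≤1+n c') (≤-reflexive (sym c≡1+c'))) ]′ lengths

  record Invariant (placed pending : List ℕ) (st : List (Maybe ℕ)) : Set where
    field
      decomposition  : S ≡ placed ++ pending
      length-st      : length st ≡ c
      entry-placed   : ∀ r {v} → rowAt st r ≡ just v → v ∈ placed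
      entry-once     : ∀ r q {v} → rowAt st r ≡ just v → rowAt st q ≡ just v → r ≡ q
      placed-entry   : ∀ {v} → v ∈ placed → ∃[ r ] rowAt st r ≡ just v
      C'-row-pending : ∀ s → s < c' → nth C' s ∈ pending → rowAt st s ≡ nothing
      C'-row-placed  : ∀ s → s < c' → nth C' s ∈ placed → rowAt st s ≡ just (nth C' s)
      below-C'       : ∀ r {v} → r < c' → rowAt st r ≡ just v → v ≤ nth C' r
      count-filled   : countIdx (filled st) c ≡ length placed

  open Invariant

  module Placing (placed : List ℕ) (a : ℕ) (pending : List ℕ) (S≡ : S ≡ placed ++ a ∷ pending) where

    private
      decreasing : AllPairs _>_ (placed ++ a ∷ pending)
      decreasing = subst (AllPairs _>_) S≡ S-decreasing

    placed>a : ∀ {v} → v ∈ placed → v > a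
    placed>a v∈ = AllPairs-++-across placed decreasing v∈ (here refl)

    pending<a : ∀ {v} → v ∈ pending → v < a
    pending<a v∈ with a>pending ∷ _ ← AllPairs-++-right placed decreasing = All.lookup a>pending v∈

    a∉placed : a ∉ placed
    a∉placed a∈ = <-irrefl refl (placed>a a∈)

    Invariant-setAt : ∀ {st} r → Invariant placed (a ∷ pending) st → r < c → rowAt st r ≡ nothing →
      (∀ s → s < c' → nth C' s ∈ pending → s ≢ r) →
      (∀ s → s < c' → nth C' s ≡ a → s ≡ r) →
      (r < c' → a ≤ nth C' r) →
      Invariant (placed ++ [ a ]) pending (setAt st r a)
    Invariant-setAt {st} r inv r<c empty r-free a-row a≤ = record
      { decomposition  = trans (decomposition inv) (sym (++-assoc placed [ a ] pending))
      ; length-st      = trans (length-setAt st r a) (length-st inv)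
      ; entry-placed   = entry-placed′
      ; entry-once     = entry-once′
      ; placed-entry   = placed-entry′
      ; C'-row-pending = λ s s< C's∈ → trans (rowAt-setAt-other st r a s (r-free s s< C's∈)) (C'-row-pending inv s s< (there C's∈))
      ; C'-row-placed  = C'-row-placed′
      ; below-C'       = below-C'′
      ; count-filled   = count-filled′
      }
      where
      st′ : List (Maybe ℕ)
      st′ = setAt st r a

      r<len : r < length st
      r<len = subst (r <_) (sym (length-st inv)) r<c

      at-r : rowAt st′ r ≡ just a
      at-r = rowAt-setAt-same st r a r<len

      at : ∀ q → (q ≡ r × rowAt st′ q ≡ just a) ⊎ (q ≢ r × rowAt st′ q ≡ rowAt st q)
      at q with q ≟ r
      ... | yes refl = inj₁ (refl , at-r)
      ... | no  q≢r  = inj₂ (q≢r , rowAt-setAt-other st r a q q≢r)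

      entry-placed′ : ∀ q {v} → rowAt st′ q ≡ just v → v ∈ placed ++ [ a ]
      entry-placed′ q eq with at q
      ... | inj₁ (_ , eq′) = ∈-++⁺ʳ placed (here (just-injective (trans (sym eq) eq′)))
      ... | inj₂ (_ , eq′) = ∈-++⁺ˡ (entry-placed inv q (trans (sym eq′) eq))

      entry-once′ : ∀ q₁ q₂ {v} → rowAt st′ q₁ ≡ just v → rowAt st′ q₂ ≡ just v → q₁ ≡ q₂
      entry-once′ q₁ q₂ eq₁ eq₂ with at q₁ | at q₂
      ... | inj₁ (q₁≡r , _)  | inj₁ (q₂≡r , _)  = trans q₁≡r (sym q₂≡r)
      ... | inj₁ (_ , eq₁′) | inj₂ (_ , eq₂′) =
        ⊥-elim (a∉placed (entry-placed inv q₂ (trans (sym eq₂′) (trans eq₂ (trans (sym eq₁) eq₁′)))))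
      ... | inj₂ (_ , eq₁′) | inj₁ (_ , eq₂′) =
        ⊥-elim (a∉placed (entry-placed inv q₁ (trans (sym eq₁′) (trans eq₁ (trans (sym eq₂) eq₂′)))))
      ... | inj₂ (_ , eq₁′) | inj₂ (_ , eq₂′) = entry-once inv q₁ q₂ (trans (sym eq₁′) eq₁) (trans (sym eq₂′) eq₂)

      placed-entry′ : ∀ {v} → v ∈ placed ++ [ a ] → ∃[ q ] rowAt st′ q ≡ just v
      placed-entry′ v∈ with ∈-++⁻ placed v∈
      ... | inj₂ (here refl) = r , at-r
      ... | inj₁ v∈placed with q , eq ← placed-entry inv v∈placed with at q
      ...   | inj₁ (refl , _) = ⊥-elim (just≢nothing (trans (sym eq) empty))
      ...   | inj₂ (_ , eq′)  = q , trans eq′ eq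

      C'-row-placed′ : ∀ s → s < c' → nth C' s ∈ placed ++ [ a ] → rowAt st′ s ≡ just (nth C' s)
      C'-row-placed′ s s< C's∈ with at s | ∈-++⁻ placed C's∈
      ... | inj₁ (refl , eq) | inj₂ (here C's≡a) = trans eq (cong just (sym C's≡a))
      ... | inj₁ (refl , _)  | inj₁ C's∈placed   = ⊥-elim (just≢nothing (trans (sym (C'-row-placed inv s s< C's∈placed)) empty))
      ... | inj₂ (s≢r , _)   | inj₂ (here C's≡a) = ⊥-elim (s≢r (a-row s s< C's≡a))
      ... | inj₂ (_ , eq)    | inj₁ C's∈placed   = trans eq (C'-row-placed inv s s< C's∈placed)

      below-C'′ : ∀ q {v} → q < c' → rowAt st′ q ≡ just v → v ≤ nth C' q
      below-C'′ q q< eq with at q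
      ... | inj₁ (refl , eq′) = subst (_≤ nth C' q) (just-injective (trans (sym eq′) eq)) (a≤ q<)
      ... | inj₂ (_ , eq′)    = below-C' inv q q< (trans (sym eq′) eq)

      count-filled′ : countIdx (filled st′) c ≡ length (placed ++ [ a ])
      count-filled′ = begin
        countIdx (filled st′) c ≡⟨ countIdx-flip (filled st) (filled st′) c r r<c (cong is-just empty) (cong is-just at-r)
                                     (λ i _ i≢r → cong is-just (rowAt-setAt-other st r a i i≢r)) ⟩
        suc (countIdx (filled st) c) ≡⟨ cong suc (count-filled inv) ⟩
        suc (length placed)          ≡⟨ +-comm 1 (length placed) ⟩
        length placed + 1            ≡⟨ length-++ placed ⟨
        length (placed ++ [ a ])     ∎
        where open ≡-Reasoning

    placed+1≤countAtLeast : length placed + 1 ≤ countAtLeast a S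
    placed+1≤countAtLeast = begin
      length placed + 1                             ≤⟨ +-monoʳ-≤ (length placed) (s≤s z≤n) ⟩
      length placed + suc (countAtLeast a pending)  ≡⟨ cong (length placed +_) (countAtLeast-accept a pending ≤-refl) ⟨
      length placed + countAtLeast a (a ∷ pending)  ≡⟨ cong (_+ _) (countAtLeast-all a (All.tabulate (<⇒≤ ∘ placed>a))) ⟨
      countAtLeast a placed + countAtLeast a (a ∷ pending) ≡⟨ countAtLeast-++ a placed (a ∷ pending) ⟨
      countAtLeast a (placed ++ a ∷ pending)        ≡⟨ cong (countAtLeast a) S≡ ⟨
      countAtLeast a S                              ∎
      where open ≤-Reasoning

    filled-within-C' : ∀ {st} → Invariant placed (a ∷ pending) st → (c ≡ suc c' → emptyAt st c' ≡ false) →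
      countIdx (filled st) c' + (c ∸ c') ≡ length placed
    filled-within-C' {st} inv extra-filled = [ equal-lengths , extra-row ]′ lengths
      where
      open ≡-Reasoning
      equal-lengths : c ≡ c' → countIdx (filled st) c' + (c ∸ c') ≡ length placed
      equal-lengths c≡c' = begin
        countIdx (filled st) c' + (c ∸ c') ≡⟨ cong₂ (λ n m → countIdx (filled st) n + m) (sym c≡c') (trans (cong (_∸ c') c≡c') (n∸n≡0 c')) ⟩
        countIdx (filled st) c + 0         ≡⟨ +-identityʳ _ ⟩
        countIdx (filled st) c             ≡⟨ count-filled inv ⟩
        length placed                      ∎
      extra-row : c ≡ suc c' → countIdx (filled st) c' + (c ∸ c') ≡ length placed
      extra-row c≡1+c' = begin
        countIdx (filled st) c' + (c ∸ c')   ≡⟨ cong (countIdx (filled st) c' +_) (trans (cong (_∸ c') c≡1+c') (m+n∸n≡m 1 c')) ⟩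
        countIdx (filled st) c' + 1          ≡⟨ cong (λ b → countIdx (filled st) c' + indicator b) last-filled ⟨
        countIdx (filled st) (suc c')        ≡⟨ cong (countIdx (filled st)) c≡1+c' ⟨
        countIdx (filled st) c               ≡⟨ count-filled inv ⟩
        length placed                        ∎
        where
        last-filled : filled st c' ≡ true
        last-filled = ¬emptyAt⇒filled st c' (subst (c' <_) (sym (trans (length-st inv) c≡1+c')) ≤-refl) (extra-filled c≡1+c')

    -- a and the placed elements are all ≥ a, while by dominance S has at most
    -- countAtLeast a C' + (c ∸ c') such elements; if c = c' + 1, the extra row
    -- already holds one placed element.
    fewer-filled-than-above-a : ∀ {st} → Invariant placed (a ∷ pending) st → (c ≡ suc c' → emptyAt st c' ≡ false) →
      countIdx (filled st) c' < countIdx (λ i → ⌊ a ≤? nth C' i ⌋) c'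
    fewer-filled-than-above-a {st} inv extra-filled = +-cancelʳ-≤ (c ∸ c') _ _ (begin
      suc (countIdx (filled st) c' + (c ∸ c'))            ≡⟨ cong suc (filled-within-C' inv extra-filled) ⟩
      suc (length placed)                                 ≡⟨ +-comm 1 (length placed) ⟩
      length placed + 1                                   ≤⟨ placed+1≤countAtLeast ⟩
      countAtLeast a S                                    ≤⟨ dominated a ⟩
      countAtLeast a C' + (c ∸ c')                        ≡⟨ cong (_+ (c ∸ c')) (countIdx-nth a C') ⟨
      countIdx (λ i → ⌊ a ≤? nth C' i ⌋) c' + (c ∸ c')    ∎)
      where open ≤-Reasoning

    free-row-above : ∀ {st} → Invariant placed (a ∷ pending) st → (c ≡ suc c' → emptyAt st c' ≡ false) →
      ∃[ i ] i < c' × emptyAt st i ≡ true × a ≤ nth C' i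
    free-row-above {st} inv extra-filled
      with i , i< , a≤C'ᵢ , unfilled ← countIdx-pigeonhole _ (filled st) c' (fewer-filled-than-above-a inv extra-filled)
      = i , i< , nothing⇒emptyAt st i i<len (is-just≡false⇒nothing unfilled) , toWitness (Equivalence.from T-≡ a≤C'ᵢ)
      where
      i<len : i < length st
      i<len = subst (i <_) (sym (length-st inv)) (≤-trans i< c'≤c)

    Invariant-hatStep : ∀ {st} → Invariant placed (a ∷ pending) st →
                        Invariant (placed ++ [ a ]) pending (hatStep c C' st a)
    Invariant-hatStep {st} inv with indexOf a C' in idx
    ... | just s with C'ₛ≡a , s< ← indexOf-just a C' s idx =
      Invariant-setAt s inv (≤-trans s< c'≤c) (C'-row-pending inv s s< (here C'ₛ≡a))
        (λ { _ _ C'ₛ∈ refl → <-irrefl C'ₛ≡a (pending<a C'ₛ∈) })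
        (λ s′ s′< C'ₛ′≡a → nth-injective C'-unique s′ s s′< s< (trans C'ₛ′≡a (sym C'ₛ≡a)))
        (λ _ → ≤-reflexive (sym C'ₛ≡a))
    ... | nothing with ⌊ c ≟ suc c' ⌋ ∧ emptyAt st c' in extra
    ...   | true with c'<len , empty ← emptyAt⇒nothing st c' (∧≡true⇒ʳ extra) =
      Invariant-setAt c' inv (subst (c' <_) (length-st inv) c'<len) empty
        (λ { _ s< _ refl → <-irrefl refl s< })
        (λ s s< C'ₛ≡a → ⊥-elim (indexOf-nothing a C' idx (subst (_∈ C') C'ₛ≡a (nth-∈ C' s s<))))
        (λ c'<c' → ⊥-elim (<-irrefl refl c'<c'))
    ...   | false
      with i , i< , empty-i , a≤C'ᵢ ← free-row-above inv (λ c≡ → subst (λ b → b ∧ emptyAt st c' ≡ false) (isYes-true (c ≟ suc c') c≡) extra)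
      with r , e , chosen , (j , refl , j< , C'ⱼ≡e) , empty-r , a≤e ←
             largestEmpty-chosen st _ a (zip (upTo c') C') (zip-applyUpTo-entries id C')
               (zip-applyUpTo-any (Candidate st a) id C' i i< (empty-i , a≤C'ᵢ))
      with r<len , empty ← emptyAt⇒nothing st r empty-r
      rewrite chosen =
      Invariant-setAt r inv (subst (r <_) (length-st inv) r<len) empty
        (λ { _ _ C'ᵣ∈ refl → <-irrefl refl (≤-trans (s≤s (subst (a ≤_) (sym C'ⱼ≡e) a≤e)) (pending<a C'ᵣ∈)) })
        (λ s s< C'ₛ≡a → ⊥-elim (indexOf-nothing a C' idx (subst (_∈ C') C'ₛ≡a (nth-∈ C' s s<))))
        (λ _ → subst (a ≤_) (sym C'ⱼ≡e) a≤e)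

  Invariant-initial : Invariant [] S (replicate c nothing)
  Invariant-initial = record
    { decomposition  = refl
    ; length-st      = length-replicate c
    ; entry-placed   = λ r eq → ⊥-elim (nothing≢just (trans (sym (rowAt-replicate c r)) eq))
    ; entry-once     = λ r _ eq _ → ⊥-elim (nothing≢just (trans (sym (rowAt-replicate c r)) eq))
    ; placed-entry   = λ ()
    ; C'-row-pending = λ s _ _ → rowAt-replicate c s
    ; C'-row-placed  = λ _ _ ()
    ; below-C'       = λ r _ eq → ⊥-elim (nothing≢just (trans (sym (rowAt-replicate c r)) eq))
    ; count-filled   = countIdx-none _ c (λ i → cong is-just (rowAt-replicate c i))
    }

  Invariant-foldl : ∀ placed pending st → Invariant placed pending st →
                    Invariant S [] (foldl (hatStep c C') st pending)
  Invariant-foldl placed []              st inv =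
    subst (λ p → Invariant p [] st) (sym (trans (decomposition inv) (++-identityʳ placed))) inv
  Invariant-foldl placed (a ∷ pending) st inv =
    Invariant-foldl (placed ++ [ a ]) pending (hatStep c C' st a)
      (Placing.Invariant-hatStep placed a pending (decomposition inv) inv)

  final : List (Maybe ℕ)
  final = foldl (hatStep c C') (replicate c nothing) S

  final-Invariant : Invariant S [] final
  final-Invariant = Invariant-foldl [] S (replicate c nothing) Invariant-initial

  Ĉ : List ℕ
  Ĉ = hat S C'

  hat-length : length Ĉ ≡ c
  hat-length = trans (length-map (fromMaybe 0) final) (length-st final-Invariant)

  final-filled : ∀ i → i < c → ∃[ v ] rowAt final i ≡ just v
  final-filled i i< with rowAt final i | countIdx≡n⇒all (filled final) c (count-filled final-Invariant) i i<
  ... | just v | _ = v , refl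

  nth-hat : ∀ i {v} → rowAt final i ≡ just v → nth Ĉ i ≡ v
  nth-hat i eq = trans (nth-fromMaybe final i) (cong (fromMaybe 0) eq)

  hat⊆S : Ĉ ⊆ S
  hat⊆S z∈ with i , i< , refl ← ∈⇒nth Ĉ z∈ with v , eq ← final-filled i (subst (i <_) hat-length i<) =
    subst (_∈ S) (sym (nth-hat i eq)) (entry-placed final-Invariant i eq)

  S⊆hat : S ⊆ Ĉ
  S⊆hat {z} z∈ with r , eq ← placed-entry final-Invariant z∈ =
    subst (_∈ Ĉ) (nth-hat r eq) (nth-∈ Ĉ r r<)
    where
    r< : r < length Ĉ
    r< = subst (r <_) (trans (length-st final-Invariant) (sym hat-length)) (rowAt-just⇒< final r eq)

  hat-unique : Unique Ĉ
  hat-unique = nth-injective⇒Unique Ĉ λ i j i< j< Ĉᵢ≡Ĉⱼ →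
    let (vᵢ , eqᵢ) = final-filled i (subst (i <_) hat-length i<)
        (vⱼ , eqⱼ) = final-filled j (subst (j <_) hat-length j<)
    in entry-once final-Invariant i j eqᵢ
         (subst (λ v → rowAt final j ≡ just v) (trans (sym (nth-hat j eqⱼ)) (trans (sym Ĉᵢ≡Ĉⱼ) (nth-hat i eqᵢ))) eqⱼ)

  hat-C'-row : ∀ s → s < c' → nth C' s ∈ S → nth Ĉ s ≡ nth C' s
  hat-C'-row s s< C'ₛ∈ = nth-hat s (C'-row-placed final-Invariant s s< C'ₛ∈)

  pivots : List ℕ
  pivots = pivotEntries Ĉ C'

  pivots↭pivot-rows : pivots ↭ map (nth Ĉ) (filter (T? ∘ isPivot Ĉ C') (upTo (length Ĉ)))
  pivots↭pivot-rows = ↭-trans (↭-reverse _) (sort-↭ _)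

  pivots⊆hat : pivots ⊆ Ĉ
  pivots⊆hat b∈ with q , q∈ , refl ← ∈-map⁻ (nth Ĉ) (∈-resp-↭ pivots↭pivot-rows b∈) =
    nth-∈ Ĉ q (∈-upTo⁻ (proj₁ (∈-filter⁻ (T? ∘ isPivot Ĉ C') q∈)))

  ∉C'⇒pivot : ∀ {b} → b ∈ S → b ∉ C' → b ∈ pivots
  ∉C'⇒pivot {b} b∈ b∉ with r , eq ← placed-entry final-Invariant b∈ =
    ∈-resp-↭ (↭-sym pivots↭pivot-rows)
      (subst (_∈ _) (nth-hat r eq)
        (∈-map⁺ (nth Ĉ) (∈-filter⁺ (T? ∘ isPivot Ĉ C') (∈-upTo⁺ r<) (Equivalence.from T-≡ (isPivot-intro Ĉ C' r pivot)))))
    where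
    r<c : r < c
    r<c = subst (r <_) (length-st final-Invariant) (rowAt-just⇒< final r eq)
    r< : r < length Ĉ
    r< = subst (r <_) (sym hat-length) r<c
    pivot : r < c' × nth Ĉ r < nth C' r ⊎ r ≡ c'
    pivot with r <? c'
    ... | yes r<c' = inj₁ (r<c' , subst (_< nth C' r) (sym (nth-hat r eq))
                             (≤∧≢⇒< (below-C' final-Invariant r r<c' eq) (λ b≡C'ᵣ → b∉ (subst (_∈ C') (sym b≡C'ᵣ) (nth-∈ C' r r<c')))))
    ... | no r≮c'  = inj₂ ([ (λ c≡c' → ⊥-elim (r≮c' (subst (r <_) c≡c' r<c)))
                            , (λ c≡1+c' → ≤-antisym (≤-pred (subst (r <_) c≡1+c' r<c)) (≮⇒≥ r≮c')) ]′ lengths)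

-- Swapping two values

-- swapVals (b , a) D is definitionally map (swapValue b a) D.
swapValue : ℕ → ℕ → ℕ → ℕ
swapValue b a x = if ⌊ x ≟ a ⌋ then b else (if ⌊ x ≟ b ⌋ then a else x)

swapValue-a : ∀ b a → swapValue b a a ≡ b
swapValue-a b a rewrite isYes-true (a ≟ a) refl = refl

swapValue-b : ∀ b a → b ≢ a → swapValue b a b ≡ a
swapValue-b b a b≢a rewrite isYes-false (b ≟ a) b≢a | isYes-true (b ≟ b) refl = refl

swapValue-other : ∀ b a x → x ≢ a → x ≢ b → swapValue b a x ≡ x
swapValue-other b a x x≢a x≢b rewrite isYes-false (x ≟ a) x≢a | isYes-false (x ≟ b) x≢b = refl

data SwapCase (b a x : ℕ) : Set where
  at-a  : x ≡ a → swapValue b a x ≡ b → SwapCase b a x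
  at-b  : x ≡ b → x ≢ a → swapValue b a x ≡ a → SwapCase b a x
  other : x ≢ a → x ≢ b → swapValue b a x ≡ x → SwapCase b a x

swapCase : ∀ b a x → SwapCase b a x
swapCase b a x with x ≟ a | x ≟ b
... | yes refl | _        = at-a refl (swapValue-a b x)
... | no  x≢a  | yes refl = at-b refl x≢a (swapValue-b x a x≢a)
... | no  x≢a  | no  x≢b  = other x≢a x≢b (swapValue-other b a x x≢a x≢b)

swapValue-b′ : ∀ b a → swapValue b a b ≡ a
swapValue-b′ b a with swapCase b a b
... | at-a  b≡a e   = trans e b≡a
... | at-b  _ _ e   = e
... | other _ b≢b _ = ⊥-elim (b≢b refl)

swapValue-involutive : ∀ b a x → swapValue b a (swapValue b a x) ≡ x
swapValue-involutive b a x with swapCase b a x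
... | at-a  refl e     rewrite e = swapValue-b′ b x
... | at-b  refl _ e   rewrite e = swapValue-a x a
... | other _ _ e      rewrite e = e

swapValue-∈ : ∀ {b a z D} → b ∈ D → a ∈ D → z ∈ D → swapValue b a z ∈ D
swapValue-∈ {b} {a} {z} b∈ a∈ z∈ with swapCase b a z
... | at-a  _ e   = subst (_∈ _) (sym e) b∈
... | at-b  _ _ e = subst (_∈ _) (sym e) a∈
... | other _ _ e = subst (_∈ _) (sym e) z∈

swapVals-⊆ : ∀ {b a D} → b ∈ D → a ∈ D → swapVals (b , a) D ⊆ D
swapVals-⊆ b∈ a∈ z∈ with y , y∈ , refl ← ∈-map⁻ _ z∈ = swapValue-∈ b∈ a∈ y∈

swapVals-⊇ : ∀ {b a D} → b ∈ D → a ∈ D → D ⊆ swapVals (b , a) D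
swapVals-⊇ {b} {a} b∈ a∈ {z} z∈ =
  subst (_∈ _) (swapValue-involutive b a z) (∈-map⁺ (swapValue b a) (swapValue-∈ b∈ a∈ z∈))

positions : ℕ → List ℕ → List Bool
positions a = map (λ x → ⌊ x ≟ a ⌋)

positions-swapVals-other : ∀ {b′ a′ a} D → a′ ≢ a → b′ ≢ a → positions a (swapVals (b′ , a′) D) ≡ positions a D
positions-swapVals-other {b′} {a′} {a} D a′≢a b′≢a =
  trans (sym (map-∘ D)) (map-cong unchanged D)
  where
  unchanged : ∀ x → ⌊ swapValue b′ a′ x ≟ a ⌋ ≡ ⌊ x ≟ a ⌋
  unchanged x with swapCase b′ a′ x
  ... | at-a  refl e   rewrite e = trans (isYes-false (b′ ≟ a) b′≢a) (sym (isYes-false (x ≟ a) a′≢a))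
  ... | at-b  refl _ e rewrite e = trans (isYes-false (a′ ≟ a) a′≢a) (sym (isYes-false (x ≟ a) b′≢a))
  ... | other _ _ e    rewrite e = refl

positions-swapVals : ∀ {b a} D → b ≢ a → positions a (swapVals (b , a) D) ≡ positions b D
positions-swapVals {b} {a} D b≢a = trans (sym (map-∘ D)) (map-cong moved D)
  where
  moved : ∀ x → ⌊ swapValue b a x ≟ a ⌋ ≡ ⌊ x ≟ b ⌋
  moved x with swapCase b a x
  ... | at-a  refl e     rewrite e = trans (isYes-false (b ≟ x) b≢a) (sym (isYes-false (x ≟ b) (b≢a ∘ sym)))
  ... | at-b  refl x≢a e rewrite e = trans (isYes-true (a ≟ a) refl) (sym (isYes-true (x ≟ x) refl))
  ... | other x≢a x≢b e  rewrite e = trans (isYes-false (x ≟ a) x≢a) (sym (isYes-false (x ≟ b) x≢b))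

positions-injective : ∀ {b b′} D → b ∈ D → positions b D ≡ positions b′ D → b ≡ b′
positions-injective {b} {b′} (x ∷ D) (here refl) eq =
  toWitness (Equivalence.from T-≡ (trans (sym (∷-injectiveˡ eq)) (isYes-true (x ≟ x) refl)))
positions-injective (x ∷ D) (there b∈) eq = positions-injective D b∈ (∷-injectiveʳ eq)

-- Admissible sequences

module Admissibility (P : List ℕ) where

  open ≡-Reasoning

  row : ℕ → List Transposition
  row a = map (λ b → (b , a)) (filter (_<? a) P)

  ∈-row⁻ : ∀ {a t} → t ∈ row a → ∃[ b ] t ≡ (b , a) × b ∈ P × b < a
  ∈-row⁻ {a} t∈ with b , b∈ , refl ← ∈-map⁻ (λ b → (b , a)) t∈ with b∈P , b<a ← ∈-filter⁻ (_<? a) b∈ =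
    b , refl , b∈P , b<a

  ∈-row⁺ : ∀ {a b} → b ∈ P → b < a → (b , a) ∈ row a
  ∈-row⁺ {a} b∈ b<a = ∈-map⁺ (λ b → (b , a)) (∈-filter⁺ (_<? a) b∈ b<a)

  act-⊆-⊇ : ∀ L D γ → Admissible (map row L) γ → L ⊆ D → P ⊆ D → act γ D ⊆ D × D ⊆ act γ D
  act-⊆-⊇ []      D _       done           _    _    = id , id
  act-⊆-⊇ (a ∷ L) D γ       (skip adm)     L⊆D  P⊆D = act-⊆-⊇ L D γ adm (L⊆D ∘ there) P⊆D
  act-⊆-⊇ (a ∷ L) D (_ ∷ γ) (pick t∈ adm) L⊆D  P⊆D
    with b , refl , b∈P , _ ← ∈-row⁻ t∈
    with D′⊆D ← swapVals-⊆ (P⊆D b∈P) (L⊆D (here refl))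
    with D⊆D′ ← swapVals-⊇ (P⊆D b∈P) (L⊆D (here refl))
    with act⊆D′ , D′⊆act ← act-⊆-⊇ L (swapVals (b , a) D) γ adm (D⊆D′ ∘ L⊆D ∘ there) (D⊆D′ ∘ P⊆D)
    = D′⊆D ∘ act⊆D′ , D′⊆act ∘ D⊆D′

  -- Later rows only move values below a, so the final row of a records which
  -- transposition, if any, row a contributed.
  positions-act : ∀ a L D γ → All (_< a) L → Admissible (map row L) γ → positions a (act γ D) ≡ positions a D
  positions-act a []       D _       _            done          = refl
  positions-act a (a′ ∷ L) D γ       (_ ∷ L<a)    (skip adm)    = positions-act a L D γ L<a adm
  positions-act a (a′ ∷ L) D (_ ∷ γ) (a′<a ∷ L<a) (pick t∈ adm) with b′ , refl , _ , b′<a′ ← ∈-row⁻ t∈ =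
    trans (positions-act a L (swapVals (b′ , a′) D) γ L<a adm)
          (positions-swapVals-other D (λ a′≡a → <-irrefl a′≡a a′<a) (λ b′≡a → <-irrefl b′≡a (<-trans b′<a′ a′<a)))

  positions-act-pick : ∀ a L D b γ → All (_< a) L → Admissible (map row L) γ → b < a →
                       positions a (act ((b , a) ∷ γ) D) ≡ positions b D
  positions-act-pick a L D b γ L<a adm b<a =
    trans (positions-act a L (swapVals (b , a) D) γ L<a adm) (positions-swapVals D (λ b≡a → <-irrefl b≡a b<a))

  skip≢pick : ∀ a L D γ₁ t γ₂ → a ∈ D → All (_< a) L →
              Admissible (map row L) γ₁ → t ∈ row a → Admissible (map row L) γ₂ → act γ₁ D ≢ act (t ∷ γ₂) D
  skip≢pick a L D γ₁ t γ₂ a∈ L<a adm₁ t∈ adm₂ eq with b , refl , _ , b<a ← ∈-row⁻ t∈ =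
    <-irrefl (sym (positions-injective D a∈ (begin
      positions a D                      ≡⟨ positions-act a L D γ₁ L<a adm₁ ⟨
      positions a (act γ₁ D)             ≡⟨ cong (positions a) eq ⟩
      positions a (act ((b , a) ∷ γ₂) D) ≡⟨ positions-act-pick a L D b γ₂ L<a adm₂ b<a ⟩
      positions b D                      ∎))) b<a

  act-injective : ∀ L D γ₁ γ₂ → AllPairs _>_ L → L ⊆ D → P ⊆ D →
    Admissible (map row L) γ₁ → Admissible (map row L) γ₂ → act γ₁ D ≡ act γ₂ D → γ₁ ≡ γ₂
  act-injective []      D _ _ _ _ _ done done _ = refl
  act-injective (a ∷ L) D γ₁ γ₂ (_ ∷ L>) L⊆D P⊆D (skip adm₁) (skip adm₂) eq =
    act-injective L D γ₁ γ₂ L> (L⊆D ∘ there) P⊆D adm₁ adm₂ eq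
  act-injective (a ∷ L) D γ₁ (t₂ ∷ γ₂) (a>L ∷ _) L⊆D _ (skip adm₁) (pick t₂∈ adm₂) eq =
    ⊥-elim (skip≢pick a L D γ₁ t₂ γ₂ (L⊆D (here refl)) a>L adm₁ t₂∈ adm₂ eq)
  act-injective (a ∷ L) D (t₁ ∷ γ₁) γ₂ (a>L ∷ _) L⊆D _ (pick t₁∈ adm₁) (skip adm₂) eq =
    ⊥-elim (skip≢pick a L D γ₂ t₁ γ₁ (L⊆D (here refl)) a>L adm₂ t₁∈ adm₁ (sym eq))
  act-injective (a ∷ L) D (t₁ ∷ γ₁) (t₂ ∷ γ₂) (a>L ∷ L>) L⊆D P⊆D (pick t₁∈ adm₁) (pick t₂∈ adm₂) eq
    with b₁ , refl , b₁∈P , b₁<a ← ∈-row⁻ t₁∈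
    with b₂ , refl , _    , b₂<a ← ∈-row⁻ t₂∈
    with refl ← positions-injective D (P⊆D b₁∈P) (begin
      positions b₁ D                      ≡⟨ positions-act-pick a L D b₁ γ₁ a>L adm₁ b₁<a ⟨
      positions a (act ((b₁ , a) ∷ γ₁) D) ≡⟨ cong (positions a) eq ⟩
      positions a (act ((b₂ , a) ∷ γ₂) D) ≡⟨ positions-act-pick a L D b₂ γ₂ a>L adm₂ b₂<a ⟩
      positions b₂ D                      ∎)
    = cong ((b₁ , a) ∷_) (act-injective L (swapVals (b₁ , a) D) γ₁ γ₂ L>
        (D⊆D′ ∘ L⊆D ∘ there) (D⊆D′ ∘ P⊆D) adm₁ adm₂ eq)
    where
    D⊆D′ : D ⊆ swapVals (b₁ , a) D
    D⊆D′ = swapVals-⊇ (P⊆D b₁∈P) (L⊆D (here refl))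

  module Reach (C' C : List ℕ) (c'≤c : length C' ≤ length C) (C-unique : Unique C)
               (C≤C' : ∀ i → i < length C' → nth C i ≤ nth C' i) where

    record AgreesOutside (L D : List ℕ) : Set where
      field
        length-D : length D ≡ length C
        D-unique : Unique D
        agree    : ∀ i → i < length C → nth D i ≡ nth C i ⊎ nth D i ∈ L × nth C i ∈ L
        C'-rows  : ∀ s → s < length C' → nth C' s ∈ L → nth D s ≡ nth C' s

    open AgreesOutside

    module _ {L D} (ag : AgreesOutside L D) where

      D-injective : ∀ i j → i < length C → j < length C → nth D i ≡ nth D j → i ≡ j
      D-injective i j i< j< = nth-injective (D-unique ag) i j (subst (i <_) (sym (length-D ag)) i<) (subst (j <_) (sym (length-D ag)) j<)

      C-injective : ∀ i j → i < length C → j < length C → nth C i ≡ nth C j → i ≡ j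
      C-injective = nth-injective C-unique

      AgreesOutside-[]⇒≡ : L ≡ [] → D ≡ C
      AgreesOutside-[]⇒≡ refl = nth-extensional D C (length-D ag) λ i i< →
        [ id , (λ ()) ∘ proj₁ ]′ (agree ag i (subst (i <_) (length-D ag) i<))

    AgreesOutside-keep : ∀ {a L D} j → j < length C → nth C j ≡ a → nth D j ≡ a →
                         AgreesOutside (a ∷ L) D → AgreesOutside L D
    AgreesOutside-keep {a} {L} {D} j j< Cⱼ≡a Dⱼ≡a ag = record
      { length-D = length-D ag
      ; D-unique = D-unique ag
      ; agree    = agree′
      ; C'-rows  = λ s s< C'ₛ∈ → C'-rows ag s s< (there C'ₛ∈)
      }
      where
      agree′ : ∀ i → i < length C → nth D i ≡ nth C i ⊎ nth D i ∈ L × nth C i ∈ L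
      agree′ i i< with nth D i ≟ nth C i | agree ag i i<
      ... | yes Dᵢ≡Cᵢ | _              = inj₁ Dᵢ≡Cᵢ
      ... | no  _     | inj₁ Dᵢ≡Cᵢ     = inj₁ Dᵢ≡Cᵢ
      ... | no  Dᵢ≢Cᵢ | inj₂ (Dᵢ∈ , Cᵢ∈) = inj₂ (Any.tail Dᵢ≢a Dᵢ∈ , Any.tail Cᵢ≢a Cᵢ∈)
        where
        Dᵢ≢a : nth D i ≢ a
        Dᵢ≢a Dᵢ≡a with refl ← D-injective ag i j i< j< (trans Dᵢ≡a (sym Dⱼ≡a)) = Dᵢ≢Cᵢ (trans Dᵢ≡a (sym Cⱼ≡a))
        Cᵢ≢a : nth C i ≢ a
        Cᵢ≢a Cᵢ≡a with refl ← C-injective ag i j i< j< (trans Cᵢ≡a (sym Cⱼ≡a)) = Dᵢ≢Cᵢ (trans Dⱼ≡a (sym Cᵢ≡a))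

    displaced-pending : ∀ {a L D} j → j < length C → nth C j ≡ a → nth D j ≢ a →
                        AgreesOutside (a ∷ L) D → nth D j ∈ L
    displaced-pending j j< Cⱼ≡a Dⱼ≢a ag with agree ag j j<
    ... | inj₁ Dⱼ≡Cⱼ     = ⊥-elim (Dⱼ≢a (trans Dⱼ≡Cⱼ Cⱼ≡a))
    ... | inj₂ (Dⱼ∈ , _) = Any.tail Dⱼ≢a Dⱼ∈

    -- If b = C'(s) were pending, D would already show it in row s, forcing s = j;
    -- then a = C(j) ≤ C'(j) = b < a.
    displaced-∉C' : ∀ {a L D} j → j < length C → nth C j ≡ a → nth D j < a → nth D j ∈ L →
                    AgreesOutside (a ∷ L) D → nth D j ∉ C'
    displaced-∉C' {a} {L} {D} j j< Cⱼ≡a b<a b∈L ag b∈C'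
      with s , s< , C'ₛ≡b ← ∈⇒nth C' b∈C'
      with refl ← D-injective ag s j (≤-trans s< c'≤c) j<
                    (trans (C'-rows ag s s< (subst (_∈ a ∷ L) (sym C'ₛ≡b) (there b∈L))) C'ₛ≡b)
      = <-irrefl refl (≤-<-trans (subst₂ _≤_ Cⱼ≡a C'ₛ≡b (C≤C' j s<)) b<a)

    AgreesOutside-swap : ∀ {a L D} j → j < length C → nth C j ≡ a → nth D j < a → nth D j ∈ L →
                         All (_< a) L → nth D j ∉ C' →
                         AgreesOutside (a ∷ L) D → AgreesOutside L (swapVals (nth D j , a) D)
    AgreesOutside-swap {a} {L} {D} j j< Cⱼ≡a b<a b∈L L<a b∉C' ag = record
      { length-D = trans (length-map (swapValue b a) D) (length-D ag)
      ; D-unique = Unique.map⁺ swapValue-injective (D-unique ag)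
      ; agree    = agree′
      ; C'-rows  = C'-rows′
      }
      where
      b : ℕ
      b = nth D j

      swapValue-injective : ∀ {x y} → swapValue b a x ≡ swapValue b a y → x ≡ y
      swapValue-injective {x} {y} eq =
        trans (sym (swapValue-involutive b a x)) (trans (cong (swapValue b a) eq) (swapValue-involutive b a y))

      nth-D′ : ∀ i → i < length C → nth (swapVals (b , a) D) i ≡ swapValue b a (nth D i)
      nth-D′ i i< = nth-map (swapValue b a) D i (subst (i <_) (sym (length-D ag)) i<)

      Cᵢ≢a : ∀ i → i < length C → nth D i ≢ b → nth C i ≢ a
      Cᵢ≢a i i< Dᵢ≢b Cᵢ≡a with refl ← C-injective ag i j i< j< (trans Cᵢ≡a (sym Cⱼ≡a)) = Dᵢ≢b refl

      agree′ : ∀ i → i < length C →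
               nth (swapVals (b , a) D) i ≡ nth C i ⊎ nth (swapVals (b , a) D) i ∈ L × nth C i ∈ L
      agree′ i i< rewrite nth-D′ i i< with swapCase b a (nth D i) | agree ag i i<
      ... | at-a Dᵢ≡a e | inj₁ Dᵢ≡Cᵢ =
        ⊥-elim (Cᵢ≢a i i< (λ Dᵢ≡b → <-irrefl (trans (sym Dᵢ≡b) Dᵢ≡a) b<a) (trans (sym Dᵢ≡Cᵢ) Dᵢ≡a))
      ... | at-a Dᵢ≡a e | inj₂ (_ , Cᵢ∈) =
        inj₂ (subst (_∈ L) (sym e) b∈L , Any.tail (Cᵢ≢a i i< (λ Dᵢ≡b → <-irrefl (trans (sym Dᵢ≡b) Dᵢ≡a) b<a)) Cᵢ∈)
      ... | at-b Dᵢ≡b _ e | _ with refl ← D-injective ag i j i< j< Dᵢ≡b = inj₁ (trans e (sym Cⱼ≡a))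
      ... | other _ _ e | inj₁ Dᵢ≡Cᵢ = inj₁ (trans e Dᵢ≡Cᵢ)
      ... | other Dᵢ≢a Dᵢ≢b e | inj₂ (Dᵢ∈ , Cᵢ∈) =
        inj₂ (subst (_∈ L) (sym e) (Any.tail Dᵢ≢a Dᵢ∈) , Any.tail (Cᵢ≢a i i< Dᵢ≢b) Cᵢ∈)

      C'-rows′ : ∀ s → s < length C' → nth C' s ∈ L → nth (swapVals (b , a) D) s ≡ nth C' s
      C'-rows′ s s< C'ₛ∈ = begin
        nth (swapVals (b , a) D) s   ≡⟨ nth-D′ s (≤-trans s< c'≤c) ⟩
        swapValue b a (nth D s)      ≡⟨ cong (swapValue b a) (C'-rows ag s s< (there C'ₛ∈)) ⟩
        swapValue b a (nth C' s)     ≡⟨ swapValue-other b a (nth C' s) (λ C'ₛ≡a → <-irrefl C'ₛ≡a (All.lookup L<a C'ₛ∈))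
                                          (λ C'ₛ≡b → b∉C' (subst (_∈ C') C'ₛ≡b (nth-∈ C' s s<))) ⟩
        nth C' s                     ∎

    reach : ∀ L D → AllPairs _>_ L → L ⊆ C → (∀ {b} → b ∈ L → b ∉ C' → b ∈ P) → AgreesOutside L D →
            ∃[ γ ] Admissible (map row L) γ × act γ D ≡ C
    reach []      D _           _   _     ag = [] , done , AgreesOutside-[]⇒≡ ag refl
    reach (a ∷ L) D (a>L ∷ L>) L⊆C pivot ag with j , j< , Cⱼ≡a ← ∈⇒nth C (L⊆C (here refl)) with nth D j ≟ a
    ... | yes Dⱼ≡a = map₂ (map₁ skip)
      (reach L D L> (L⊆C ∘ there) (pivot ∘ there) (AgreesOutside-keep j j< Cⱼ≡a Dⱼ≡a ag))
    ... | no  Dⱼ≢a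
      with b∈L  ← displaced-pending j j< Cⱼ≡a Dⱼ≢a ag
      with b<a  ← All.lookup a>L b∈L
      with b∉C' ← displaced-∉C' j j< Cⱼ≡a b<a b∈L ag
      with γ , adm , eq ← reach L (swapVals (nth D j , a) D) L> (L⊆C ∘ there) (pivot ∘ there)
                            (AgreesOutside-swap j j< Cⱼ≡a b<a b∈L a>L b∉C' ag)
      = (nth D j , a) ∷ γ , pick (∈-row⁺ (pivot (there b∈L) b∉C') b<a) adm , eq

HHL⇒length≥ : ∀ {C C'} → HHL C C' → length C' ≤ length C
HHL⇒length≥ hhl = [ ≤-reflexive ∘ sym , (λ eq → ≤-trans (n≤1+n _) (≤-reflexive (sym eq))) ]′ (HHL.lengths hhl)

HHL⇒rows≤ : ∀ {C C'} → HHL C C' → ∀ i → i < length C' → nth C i ≤ nth C' i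
HHL⇒rows≤ {C} {C'} hhl i i< =
  subst₂ _≤_ (lookup-fromℕ< C i i<C) (lookup-fromℕ< C' i i<)
    (HHL.rowLe hhl (fromℕ< i<C) (fromℕ< i<) (trans (toℕ-fromℕ< i<C) (sym (toℕ-fromℕ< i<))))
  where
  i<C : i < length C
  i<C = ≤-trans i< (HHL⇒length≥ hhl)

proposition4p2 : (C' S : List ℕ) →
    Unique C' → All (1 ≤_) C' →
    All (1 ≤_) S → Linked _>_ S →
    (length S ≡ length C' ⊎ length S ≡ suc (length C')) →
    Pointwise _≤_ (take (length C') (reverse S)) (sortℕ C') →
    ((γ : List Transposition) → Admissible (beta S C') γ →
       HHL (act γ (hat S C')) C' → act γ (hat S C') ↭ S)
    × ((γ₁ γ₂ : List Transposition) →
       Admissible (beta S C') γ₁ → Admissible (beta S C') γ₂ →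
       HHL (act γ₁ (hat S C')) C' → HHL (act γ₂ (hat S C')) C' →
       act γ₁ (hat S C') ≡ act γ₂ (hat S C') → γ₁ ≡ γ₂)
    × ((C : List ℕ) → C ↭ S → HHL C C' →
       ∃ λ γ → Admissible (beta S C') γ × HHL (act γ (hat S C')) C' × act γ (hat S C') ≡ C)
proposition4p2 C' S C'-unique _ _ S-linked lengths dominance = generated , injective , surjective
  where
  S-decreasing : AllPairs _>_ S
  S-decreasing = Linked⇒AllPairs (λ y<x z<y → <-trans z<y y<x) S-linked

  open HatConstruction C' S C'-unique S-decreasing lengths (smallest-dominated⇒countAtLeast≤ C' S dominance)
  -- With P = pivots, map row S is definitionally beta S C'.
  open Admissibility pivots

  generated : (γ : List Transposition) → Admissible (beta S C') γ → HHL (act γ Ĉ) C' → act γ Ĉ ↭ S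
  generated γ adm hhl with act⊆Ĉ , Ĉ⊆act ← act-⊆-⊇ S Ĉ γ adm S⊆hat pivots⊆hat =
    unique-⊆-⊇⇒↭ (HHL.distinctL hhl) (AllPairs>⇒Unique S-decreasing) (hat⊆S ∘ act⊆Ĉ) (Ĉ⊆act ∘ S⊆hat)

  injective : (γ₁ γ₂ : List Transposition) → Admissible (beta S C') γ₁ → Admissible (beta S C') γ₂ →
              HHL (act γ₁ Ĉ) C' → HHL (act γ₂ Ĉ) C' → act γ₁ Ĉ ≡ act γ₂ Ĉ → γ₁ ≡ γ₂
  injective γ₁ γ₂ adm₁ adm₂ _ _ = act-injective S Ĉ γ₁ γ₂ S-decreasing S⊆hat pivots⊆hat adm₁ adm₂

  surjective : (C : List ℕ) → C ↭ S → HHL C C' →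
               ∃ λ γ → Admissible (beta S C') γ × HHL (act γ Ĉ) C' × act γ Ĉ ≡ C
  surjective C C↭S hhl =
    let γ , adm , eq = reach S Ĉ S-decreasing (∈-resp-↭ (↭-sym C↭S)) ∉C'⇒pivot start
    in  γ , adm , subst (λ X → HHL X C') (sym eq) hhl , eq
    where
    open Reach C' C (HHL⇒length≥ hhl) (HHL.distinctL hhl) (HHL⇒rows≤ hhl)
    start : AgreesOutside S Ĉ
    start = record
      { length-D = trans hat-length (sym (↭-length C↭S))
      ; D-unique = hat-unique
      ; agree    = λ i i< → inj₂ ( hat⊆S (nth-∈ Ĉ i (subst (i <_) (trans (↭-length C↭S) (sym hat-length)) i<))
                                  , ∈-resp-↭ C↭S (nth-∈ C i i<))
      ; C'-rows  = hat-C'-row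
      }
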